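{- Let $G$ be a graph with $n(G)\ge 2$ and let $H$ be a graph. Then $\gamma_{\mathrm{MB}}(G\odot H)=3$ if and only if either $n(G)=2$ and $\gamma_{\mathrm{MB}}(H)=2$, or $n(G)=3$ and $H$ has a dominating vertex.
   Context: All graphs are finite and simple; $n(G)$ denotes the order of $G$; a dominating vertex is a vertex adjacent to all other vertices. The Maker-Breaker domination game on a graph $G$: Dominator and Staller alternately select a not yet selected vertex of $G$. Dominator wins if his selected vertices contain a dominating set of $G$; Staller wins if she selects at least one vertex from every dominating set of $G$. In the D-game Dominator moves first. $\gamma_{\mathrm{MB}}(G)$ is the minimum number of moves Dominator needs to win the D-game on $G$ when both players play optimally, and is $\infty$ if Dominator has no winning strategy. The corona $G\odot H$ is obtained from one copy of $G$ and $n(G)$ disjoint copies of $H$ by joining the $i$-th vertex of $G$ to every vertex of the $i$-th copy of $H$. -}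

module Defs where

open import Data.Nat using (ℕ; zero; suc; _+_; _*_; _<_)
open import Data.Fin using (Fin; splitAt; remQuot)
open import Data.Fin.Properties using (_≟_)
open import Data.Fin.Subset using (Subset; _∈_; _∉_; _∪_; ⁅_⁆; ⊥)
open import Data.Bool using (Bool; true; false; _∧_)
open import Data.Bool.Properties using (∧-comm)
open import Data.Sum using (_⊎_; inj₁; inj₂)
open import Data.Product using (_×_; _,_; ∃; ∃-syntax)
open import Relation.Nullary using (¬_; yes; no)
open import Relation.Nullary.Decidable using (⌊_⌋)
open import Relation.Binary.PropositionalEquality using (_≡_; _≢_; refl; sym; cong₂)

record Graph (n : ℕ) : Set where
  field
    adj     : Fin n → Fin n → Bool
    adj-sym : ∀ i j → adj i j ≡ adj j i
    adj-irr : ∀ i → adj i i ≡ false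
open Graph public

Dominates : ∀ {n} → Graph n → Subset n → Set
Dominates G D = ∀ v → v ∈ D ⊎ ∃[ u ] (u ∈ D × adj G u v ≡ true)

IsDominatingVertex : ∀ {n} → Graph n → Fin n → Set
IsDominatingVertex G v = ∀ u → u ≢ v → adj G v u ≡ true

HasDominatingVertex : ∀ {n} → Graph n → Set
HasDominatingVertex G = ∃[ v ] IsDominatingVertex G v

Free : ∀ {n} → Subset n → Subset n → Fin n → Set
Free D S v = v ∉ D × v ∉ S

-- Maker-Breaker domination game, Dominator to move, D = Dominator's
-- vertices so far, S = Staller's vertices so far.
-- DWins G k D S : Dominator can force a win using at most k further moves.  After Dominator's
-- move, if he has not won, Staller must select a free vertex; if none is
-- left the game is over and Dominator has lost.
data DWins {n} (G : Graph n) : ℕ → Subset n → Subset n → Set where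
  won  : ∀ {k D S} → Dominates G D → DWins G k D S
  move : ∀ {k D S} (v : Fin n) → Free D S v →
         ( Dominates G (D ∪ ⁅ v ⁆)
         ⊎ ( ∃[ w ] Free (D ∪ ⁅ v ⁆) S w
           × (∀ w → Free (D ∪ ⁅ v ⁆) S w → DWins G k (D ∪ ⁅ v ⁆) (S ∪ ⁅ w ⁆)) ) )
         → DWins G (suc k) D S

-- γ_MB(G) = k : Dominator wins the D-game in at most k moves, and in no
-- fewer (γ_MB(G) = ∞ means no k satisfies this).
γMB≡ : ∀ {n} → Graph n → ℕ → Set
γMB≡ G k = DWins G k ⊥ ⊥ × (∀ j → j < k → ¬ DWins G j ⊥ ⊥)

-- Corona G ⊙ H.  Vertices of the corona: Fin (n + n * m), where
-- inj₁ i (via splitAt) is vertex i of G, and inj₂ c with remQuot m c = (a , x)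
-- is vertex x of the a-th copy of H.
private
  eqb : ∀ {n} → Fin n → Fin n → Bool
  eqb a b = ⌊ a ≟ b ⌋

  eqb-sym : ∀ {n} (a b : Fin n) → eqb a b ≡ eqb b a
  eqb-sym a b with a ≟ b | b ≟ a
  ... | yes _ | yes _ = refl
  ... | no _  | no _  = refl
  ... | yes p | no q  with q (sym p)
  ... | ()
  eqb-sym a b | no q | yes p with q (sym p)
  ... | ()

  eqb-refl : ∀ {n} (a : Fin n) → eqb a a ≡ true
  eqb-refl a with a ≟ a
  ... | yes _ = refl
  ... | no q with q refl
  ... | ()

CoronaV : ℕ → ℕ → Set
CoronaV n m = Fin n ⊎ (Fin n × Fin m)

coronaAdjV : ∀ {n m} → Graph n → Graph m → CoronaV n m → CoronaV n m → Bool
coronaAdjV G H (inj₁ i)       (inj₁ j)       = adj G i j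
coronaAdjV G H (inj₁ i)       (inj₂ (a , x)) = eqb i a
coronaAdjV G H (inj₂ (a , x)) (inj₁ i)       = eqb a i
coronaAdjV G H (inj₂ (a , x)) (inj₂ (b , y)) = eqb a b ∧ adj H x y

decode : ∀ n m → Fin (n + n * m) → CoronaV n m
decode n m c with splitAt n c
... | inj₁ i = inj₁ i
... | inj₂ d = inj₂ (remQuot m d)

private
  coronaAdjV-sym : ∀ {n m} (G : Graph n) (H : Graph m) u v →
                   coronaAdjV G H u v ≡ coronaAdjV G H v u
  coronaAdjV-sym G H (inj₁ i) (inj₁ j) = adj-sym G i j
  coronaAdjV-sym G H (inj₁ i) (inj₂ (a , x)) = eqb-sym i a
  coronaAdjV-sym G H (inj₂ (a , x)) (inj₁ i) = eqb-sym a i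
  coronaAdjV-sym G H (inj₂ (a , x)) (inj₂ (b , y)) =
    cong₂ _∧_ (eqb-sym a b) (adj-sym H x y)

  coronaAdjV-irr : ∀ {n m} (G : Graph n) (H : Graph m) u →
                   coronaAdjV G H u u ≡ false
  coronaAdjV-irr G H (inj₁ i) = adj-irr G i
  coronaAdjV-irr G H (inj₂ (a , x)) rewrite eqb-refl a = adj-irr H x

corona : ∀ {n m} → Graph n → Graph m → Graph (n + n * m)
corona {n} {m} G H = record
  { adj     = λ c d → coronaAdjV G H (decode n m c) (decode n m d)
  ; adj-sym = λ c d → coronaAdjV-sym G H (decode n m c) (decode n m d)
  ; adj-irr = λ c → coronaAdjV-irr G H (decode n m c)
  }

-- If H has a dominating vertex h, every set meeting each of the n(G) pairs {g, h_g}
-- (a vertex g of G and the copy of h attached to it) dominates G ⊙ H, so Dominator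
-- wins in n(G) moves by answering Staller inside each pair.  Conversely, Staller
-- answers Dominator's first move by taking the vertex g_b of G in another copy b.
-- From then on the copy H_b can only be dominated from inside, so Dominator's play
-- restricted to H_b is a strategy for H, and each of the n(G) − 2 remaining copies
-- costs him a further move: a win in 1 + k moves yields a win on H in
-- k − (n(G) − 2) moves.  For k = 2 this leaves n(G) = 2 with γ_MB(H) ≤ 2, where
-- γ_MB(H) = 1 is excluded since a dominating vertex of H would give a win on G ⊙ H
-- in two moves, or n(G) = 3 with H won in one move, i.e. having a dominating
-- vertex.  For n(G) = 2 Dominator takes one vertex of G and then either the other
-- one or, if Staller took it, plays H in its copy.

module Submission where

open import Defs
open import Data.Bool using (Bool; true; false; not; _∧_)
open import Data.Bool.Properties using (not-¬; T-≡)
open import Data.Empty using (⊥-elim)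
open import Data.Fin using (Fin; zero; suc; _↑ˡ_; _↑ʳ_; combine; splitAt)
open import Data.Fin.Properties
  using (any?; _≟_; ↑ˡ-injective; ↑ʳ-injective; splitAt-↑ˡ; splitAt-↑ʳ; join-splitAt;
         combine-injective; combine-surjective; remQuot-combine)
open import Data.Fin.Subset
  using (Subset; _∈_; _∉_; _⊆_; _∪_; _─_; _-_; ⁅_⁆; ⊥; ⊤; ∣_∣; Empty; inside; outside)
open import Data.Fin.Subset.Properties
  using (_∈?_; ⊆-reflexive; ⊆-antisym; ∉⊥; ∈⊤; ∣⊤∣≡n; ∣⊥∣≡0; x∈⁅x⁆; x∈⁅y⁆⇒x≡y;
         x∈p∪q⁻; p⊆p∪q; q⊆p∪q; p─⊥≡p; p─q⊆p; x∈p∧x≢y⇒x∈p-y; Empty-unique; nonempty?)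
open import Data.Nat using (ℕ; zero; suc; _+_; _*_; _∸_; _≤_; s≤s; z≤n)
open import Data.Nat.Properties
  using (suc-injective; ≤-reflexive; m≤n⇒m≤1+n; n≤1+n; ∸-monoˡ-≤; +-∸-assoc)
open import Data.Product using (_×_; _,_; ∃; ∃-syntax; proj₁; proj₂; map₁)
open import Data.Sum as Sum using (_⊎_; inj₁; inj₂; [_,_]′)
open import Data.Vec using (_∷_; here; there; lookup; tabulate)
open import Data.Vec.Properties using (lookup∘tabulate; []=⇒lookup; lookup⇒[]=)
open import Function using (_∘_; id; case_of_)
open import Function.Bundles using (Equivalence; _⇔_; mk⇔)
open import Function.Definitions using (Injective)
open import Relation.Nullary using (¬_; Dec; yes; no; _×-dec_; _⊎-dec_)
import Relation.Nullary.Decidable as Dec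
open import Relation.Nullary.Decidable using (⌊_⌋; toWitness; fromWitness)
open import Relation.Binary.PropositionalEquality
  using (_≡_; _≢_; refl; sym; trans; cong; subst; subst₂; module ≡-Reasoning)

private
  variable
    M N k : ℕ
    x y z : Fin N
    p q D S S′ : Subset N
    v w : Fin N

∈-∪⁅⁆⁻ : ∀ (p : Subset N) → x ∈ p ∪ ⁅ y ⁆ → x ∈ p ⊎ x ≡ y
∈-∪⁅⁆⁻ {y = y} p = Sum.map₂ (x∈⁅y⁆⇒x≡y y) ∘ x∈p∪q⁻ p ⁅ y ⁆

x∈p⇒x∈p∪⁅y⁆ : x ∈ p → x ∈ p ∪ ⁅ y ⁆
x∈p⇒x∈p∪⁅y⁆ {y = y} = p⊆p∪q ⁅ y ⁆

y∈p∪⁅y⁆ : y ∈ p ∪ ⁅ y ⁆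
y∈p∪⁅y⁆ {y = y} {p = p} = q⊆p∪q p ⁅ y ⁆ (x∈⁅x⁆ y)

x∉p∪⁅y⁆ : x ∉ p → x ≢ y → x ∉ p ∪ ⁅ y ⁆
x∉p∪⁅y⁆ {p = p} x∉p x≢y = [ x∉p , x≢y ]′ ∘ ∈-∪⁅⁆⁻ p

∪⁅⁆-⊆ : p ⊆ q → y ∈ q ∪ ⁅ z ⁆ → p ∪ ⁅ y ⁆ ⊆ q ∪ ⁅ z ⁆
∪⁅⁆-⊆ {p = p} p⊆q y∈ x∈ with ∈-∪⁅⁆⁻ p x∈
... | inj₁ x∈p = x∈p⇒x∈p∪⁅y⁆ (p⊆q x∈p)
... | inj₂ refl = y∈

x∈p─q⇒x∉q : ∀ (p q : Subset N) → x ∈ p ─ q → x ∉ q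
x∈p─q⇒x∉q {x = zero}  (_ ∷ p) (outside ∷ q) _ ()
x∈p─q⇒x∉q {x = zero}  (_ ∷ p) (inside ∷ q) ()
x∈p─q⇒x∉q {x = suc x} (_ ∷ p) (_ ∷ q) (there x∈) (there x∈q) = x∈p─q⇒x∉q p q x∈ x∈q

x∈p-y⇒x≢y : x ∈ p - y → x ≢ y
x∈p-y⇒x≢y {p = p} {y = y} x∈ refl = x∈p─q⇒x∉q p ⁅ y ⁆ x∈ (x∈⁅x⁆ y)

x∈p-y⇒x∈p : x ∈ p - y → x ∈ p
x∈p-y⇒x∈p {p = p} {y = y} = p─q⊆p p ⁅ y ⁆

x∈p⇒∣p∣≡1+∣p-x∣ : x ∈ p → ∣ p ∣ ≡ suc ∣ p - x ∣
x∈p⇒∣p∣≡1+∣p-x∣ {x = zero}  {p = inside ∷ p}  here       = cong (suc ∘ ∣_∣) (sym (p─⊥≡p p))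
x∈p⇒∣p∣≡1+∣p-x∣ {x = suc x} {p = inside ∷ p}  (there x∈) = cong suc (x∈p⇒∣p∣≡1+∣p-x∣ x∈)
x∈p⇒∣p∣≡1+∣p-x∣ {x = suc x} {p = outside ∷ p} (there x∈) = x∈p⇒∣p∣≡1+∣p-x∣ x∈

Empty⇒∣p∣≡0 : ∀ {N} {p : Subset N} → Empty p → ∣ p ∣ ≡ 0
Empty⇒∣p∣≡0 {N} empty = trans (cong ∣_∣ (Empty-unique empty)) (∣⊥∣≡0 N)

-- Opaque, so that the sets in a goal stated with preimage can be inferred.
opaque
  preimage : (Fin M → Fin N) → Subset N → Subset M
  preimage f p = tabulate (λ x → lookup p (f x))

  ∈-preimage⁺ : ∀ (f : Fin M → Fin N) → f x ∈ p → x ∈ preimage f p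
  ∈-preimage⁺ {x = x} f fx∈p = lookup⇒[]= x _ (trans (lookup∘tabulate _ x) ([]=⇒lookup fx∈p))

  ∈-preimage⁻ : ∀ (f : Fin M → Fin N) → x ∈ preimage f p → f x ∈ p
  ∈-preimage⁻ {x = x} {p = p} f x∈ =
    lookup⇒[]= (f x) p (trans (sym (lookup∘tabulate _ x)) ([]=⇒lookup x∈))

module _ (f : Fin M → Fin N) where

  preimage-mono : p ⊆ q → preimage f p ⊆ preimage f q
  preimage-mono p⊆q = ∈-preimage⁺ f ∘ p⊆q ∘ ∈-preimage⁻ f

  preimage-⊥ : preimage f ⊥ ≡ ⊥
  preimage-⊥ = Empty-unique λ (_ , x∈) → ∉⊥ (∈-preimage⁻ f x∈)

  preimage-∪⁅⁆ : Injective _≡_ _≡_ f → preimage f (p ∪ ⁅ f x ⁆) ≡ preimage f p ∪ ⁅ x ⁆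
  preimage-∪⁅⁆ {p = p} f-inj = ⊆-antisym
    ([ x∈p⇒x∈p∪⁅y⁆ ∘ ∈-preimage⁺ f , (λ { refl → y∈p∪⁅y⁆ }) ∘ f-inj ]′ ∘ ∈-∪⁅⁆⁻ p ∘ ∈-preimage⁻ f)
    (∈-preimage⁺ f ∘ [ x∈p⇒x∈p∪⁅y⁆ ∘ ∈-preimage⁻ f , (λ { refl → y∈p∪⁅y⁆ }) ]′
                   ∘ ∈-∪⁅⁆⁻ (preimage f p))

  preimage-∪⁅⁆-∉ : (∀ x → f x ≢ y) → preimage f (p ∪ ⁅ y ⁆) ≡ preimage f p
  preimage-∪⁅⁆-∉ {p = p} y∉f = ⊆-antisym
    (λ {x} → [ ∈-preimage⁺ f , ⊥-elim ∘ y∉f x ]′ ∘ ∈-∪⁅⁆⁻ p ∘ ∈-preimage⁻ f)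
    (preimage-mono x∈p⇒x∈p∪⁅y⁆)

free? : ∀ (D S : Subset N) x → Dec (Free D S x)
free? D S x = Dec.¬? (x ∈? D) ×-dec Dec.¬? (x ∈? S)

DWinsAfter : Graph N → ℕ → Subset N → Subset N → Fin N → Set
DWinsAfter Γ k D S v =
  Dominates Γ (D ∪ ⁅ v ⁆) ⊎
  ∃[ w ] Free (D ∪ ⁅ v ⁆) S w × (∀ w → Free (D ∪ ⁅ v ⁆) S w → DWins Γ k (D ∪ ⁅ v ⁆) (S ∪ ⁅ w ⁆))

module _ {Γ : Graph N} where

  DWins-mono : ∀ {j} → j ≤ k → DWins Γ j D S → DWins Γ k D S
  DWins-mono _         (won d)                             = won d
  DWins-mono (s≤s j≤k) (move v fv (inj₁ d))                = move v fv (inj₁ d)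
  DWins-mono (s≤s j≤k) (move v fv (inj₂ (w , fw , next))) =
    move v fv (inj₂ (w , fw , λ w′ fw′ → DWins-mono j≤k (next w′ fw′)))

  -- A Staller answer that is already hers in S′ is replaced by the free vertex w′
  -- that the strategy for S′ promises.
  DWins-antimonoˢ : S ⊆ S′ → DWins Γ k D S′ → DWins Γ k D S
  DWins-antimonoˢ S⊆S′ (won d) = won d
  DWins-antimonoˢ S⊆S′ (move v (v∉D , v∉S′) (inj₁ d)) = move v (v∉D , v∉S′ ∘ S⊆S′) (inj₁ d)
  DWins-antimonoˢ {S′ = S′} S⊆S′ (move v (v∉D , v∉S′) (inj₂ (w′ , (w′∉D , w′∉S′) , next))) =
    move v (v∉D , v∉S′ ∘ S⊆S′) (inj₂ (w′ , (w′∉D , w′∉S′ ∘ S⊆S′) , answer))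
    where
    answer : ∀ w → Free _ _ w → DWins Γ _ _ _
    answer w (w∉D , _) with w ∈? S′
    ... | yes w∈S′ = DWins-antimonoˢ (∪⁅⁆-⊆ S⊆S′ (x∈p⇒x∈p∪⁅y⁆ w∈S′)) (next w′ (w′∉D , w′∉S′))
    ... | no w∉S′  = DWins-antimonoˢ (∪⁅⁆-⊆ S⊆S′ y∈p∪⁅y⁆) (next w (w∉D , w∉S′))

  DWins-stuck⇒Dominates : ¬ ∃ (Free D S) → S ⊆ S′ → DWins Γ k D S′ → Dominates Γ D
  DWins-stuck⇒Dominates _     _    (won d)                 = d
  DWins-stuck⇒Dominates stuck S⊆S′ (move v (v∉D , v∉S′) _) = ⊥-elim (stuck (v , v∉D , v∉S′ ∘ S⊆S′))

  ¬Dominates-⊥ : Fin N → ¬ Dominates Γ ⊥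
  ¬Dominates-⊥ x d = [ ∉⊥ , ∉⊥ ∘ proj₁ ∘ proj₂ ]′ (d x)

  ¬DWins-0 : Fin N → ¬ DWins Γ 0 ⊥ ⊥
  ¬DWins-0 x (won d) = ¬Dominates-⊥ x d

  Dominates-⁅v⁆⇒IsDominatingVertex : Dominates Γ (⊥ ∪ ⁅ v ⁆) → IsDominatingVertex Γ v
  Dominates-⁅v⁆⇒IsDominatingVertex d u u≢v with d u
  ... | inj₁ u∈ = ⊥-elim (x∉p∪⁅y⁆ ∉⊥ u≢v u∈)
  ... | inj₂ (u′ , u′∈ , u′~u) with ∈-∪⁅⁆⁻ ⊥ u′∈
  ...   | inj₁ u′∈⊥ = ⊥-elim (∉⊥ u′∈⊥)
  ...   | inj₂ refl = u′~u

  DWins-1⇒HasDominatingVertex : Fin N → DWins Γ 1 ⊥ ⊥ → HasDominatingVertex Γ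
  DWins-1⇒HasDominatingVertex x (won d) = ⊥-elim (¬Dominates-⊥ x d)
  DWins-1⇒HasDominatingVertex x (move v _ (inj₁ d)) = v , Dominates-⁅v⁆⇒IsDominatingVertex d
  DWins-1⇒HasDominatingVertex x (move v _ (inj₂ (w , fw , next))) with next w fw
  ... | won d = v , Dominates-⁅v⁆⇒IsDominatingVertex d

any-Bool? : {P : Bool → Set} → (∀ s → Dec (P s)) → Dec (∃ P)
any-Bool? P? = Dec.map′ [ (true ,_) , (false ,_) ]′ (λ { (true , p) → inj₁ p ; (false , p) → inj₂ p })
                        (P? true ⊎-dec P? false)

-- Dominator's pairing strategy: whenever Staller takes a vertex of an untouched
-- pair, take its partner; otherwise take a vertex of any untouched pair.
module PairingStrategy {n} (Γ : Graph N) (pair : Fin n × Bool → Fin N)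
  (pair-injective : Injective _≡_ _≡_ pair)
  (covering-dominates : ∀ D → (∀ i → ∃[ s ] pair (i , s) ∈ D) → Dominates Γ D)
  where

  Intact : Subset N → Subset N → Fin n → Set
  Intact D S i = ∀ s → Free D S (pair (i , s))

  Covered : Subset N → Fin n → Set
  Covered D i = ∃[ s ] pair (i , s) ∈ D

  SafeAt : Subset n → Subset N → Subset N → Fin n → Set
  SafeAt R D S i = (i ∈ R → Intact D S i) × (i ∉ R → Covered D i)

  Safe : Subset n → Subset N → Subset N → Set
  Safe R D S = ∀ i → SafeAt R D S i

  Safe-∅⇒Dominates : ∀ {R} → Safe R D S → Empty R → Dominates Γ D
  Safe-∅⇒Dominates safe empty = covering-dominates _ λ i → proj₂ (safe i) (λ i∈R → empty (i , i∈R))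

  Safe-take : ∀ {R i s} → (∀ j → j ≢ i → SafeAt R D S j) → Safe (R - i) (D ∪ ⁅ pair (i , s) ⁆) S
  Safe-take {i = i} {s} safe j with j ≟ i
  ... | yes refl = (λ j∈ → ⊥-elim (x∈p-y⇒x≢y j∈ refl)) , (λ _ → s , y∈p∪⁅y⁆)
  ... | no j≢i   = intact ∘ proj₁ (safe j j≢i) ∘ x∈p-y⇒x∈p ,
                   covered ∘ proj₂ (safe j j≢i) ∘ λ j∉ j∈R → j∉ (x∈p∧x≢y⇒x∈p-y j∈R j≢i)
    where
    intact : Intact D S j → Intact (D ∪ ⁅ pair (i , s) ⁆) S j
    intact free s′ = x∉p∪⁅y⁆ (proj₁ (free s′)) (j≢i ∘ cong proj₁ ∘ pair-injective) , proj₂ (free s′)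
    covered : Covered D j → Covered (D ∪ ⁅ pair (i , s) ⁆) j
    covered (s′ , ∈D) = s′ , x∈p⇒x∈p∪⁅y⁆ ∈D

  SafeAt-answer : ∀ {R j} → SafeAt R D S j → (j ∈ R → ∀ s → pair (j , s) ≢ w) → SafeAt R D (S ∪ ⁅ w ⁆) j
  SafeAt-answer (intact , covered) missed =
    (λ j∈R s → let (∉D , ∉S) = intact j∈R s in ∉D , x∉p∪⁅y⁆ ∉S (missed j∈R s)) , covered

  Safe-answer : ∀ {R} → Safe R D S →
                Safe R D (S ∪ ⁅ w ⁆) ⊎
                ∃[ i ] ∃[ s ] i ∈ R × Free D (S ∪ ⁅ w ⁆) (pair (i , s))
                            × (∀ j → j ≢ i → SafeAt R D (S ∪ ⁅ w ⁆) j)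
  Safe-answer {D = D} {S = S} {w = w} {R} safe
    with any? (λ i → any-Bool? (λ s → i ∈? R ×-dec pair (i , s) ≟ w))
  ... | no miss = inj₁ λ j → SafeAt-answer (safe j) (λ j∈R s eq → miss (j , s , j∈R , eq))
  ... | yes (i , s , i∈R , refl) =
    inj₂ (i , not s , i∈R , partner-free ,
          λ j j≢i → SafeAt-answer (safe j) (λ _ _ → j≢i ∘ cong proj₁ ∘ pair-injective))
    where
    partner-free : Free D (S ∪ ⁅ pair (i , s) ⁆) (pair (i , not s))
    partner-free = let (∉D , ∉S) = proj₁ (safe i) i∈R (not s) in
                   ∉D , x∉p∪⁅y⁆ ∉S (not-¬ refl ∘ sym ∘ cong proj₂ ∘ pair-injective)

  mutual
    Safe⇒DWins : ∀ {R} → Safe R D S → ∣ R ∣ ≤ k → DWins Γ k D S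
    Safe⇒DWins {R = R} safe ∣R∣≤k with nonempty? R
    ... | no empty = won (Safe-∅⇒Dominates safe empty)
    ... | yes (i , i∈R) = move-to-Safe⇒DWins (proj₁ (safe i) i∈R true) (Safe-take (λ j _ → safe j))
                                         (subst (_≤ _) (x∈p⇒∣p∣≡1+∣p-x∣ i∈R) ∣R∣≤k)

    move-to-Safe⇒DWins : ∀ {R} → Free D S v → Safe R (D ∪ ⁅ v ⁆) S → suc ∣ R ∣ ≤ k → DWins Γ k D S
    move-to-Safe⇒DWins {R = R} fv safe (s≤s ∣R∣≤k) = move _ fv reply
      where
      answer : ∀ w → Free _ _ w → DWins Γ _ _ _
      answer w _ with Safe-answer safe
      ... | inj₁ safe′ = Safe⇒DWins safe′ ∣R∣≤k
      ... | inj₂ (i , s , i∈R , partner-free , safe′) =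
        move-to-Safe⇒DWins partner-free (Safe-take safe′) (subst (_≤ _) (x∈p⇒∣p∣≡1+∣p-x∣ i∈R) ∣R∣≤k)
      reply : DWinsAfter Γ _ _ _ _
      reply with nonempty? R
      ... | no empty = inj₁ (Safe-∅⇒Dominates safe empty)
      ... | yes (i , i∈R) = inj₂ (pair (i , true) , proj₁ (safe i) i∈R true , answer)

  pairing-strategy : DWins Γ n ⊥ ⊥
  pairing-strategy =
    Safe⇒DWins {R = ⊤} (λ i → (λ _ _ → ∉⊥ , ∉⊥) , (λ i∉⊤ → ⊥-elim (i∉⊤ ∈⊤))) (≤-reflexive (∣⊤∣≡n n))

≟-true⇒≡ : ∀ {i j : Fin N} → ⌊ i ≟ j ⌋ ≡ true → i ≡ j
≟-true⇒≡ = toWitness ∘ Equivalence.from T-≡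

≟-refl : ∀ (i : Fin N) → ⌊ i ≟ i ⌋ ≡ true
≟-refl i = Equivalence.to T-≡ (fromWitness refl)

∧≡true⁻ : ∀ {b c} → b ∧ c ≡ true → b ≡ true × c ≡ true
∧≡true⁻ {true} c≡true = refl , c≡true

module Corona {n m} (G : Graph n) (H : Graph m) where

  G⊙H : Graph (n + n * m)
  G⊙H = corona G H

  inG : Fin n → Fin (n + n * m)
  inG i = i ↑ˡ (n * m)

  inH : Fin n → Fin m → Fin (n + n * m)
  inH a x = n ↑ʳ combine a x

  decode-inG : ∀ i → decode n m (inG i) ≡ inj₁ i
  decode-inG i rewrite splitAt-↑ˡ n i (n * m) = refl

  decode-inH : ∀ a x → decode n m (inH a x) ≡ inj₂ (a , x)
  decode-inH a x rewrite splitAt-↑ʳ n (n * m) (combine a x) | remQuot-combine {n} {m} a x = refl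

  data View : Fin (n + n * m) → Set where
    vertex-of-G : ∀ i → View (inG i)
    vertex-of-H : ∀ a x → View (inH a x)

  view : ∀ v → View v
  view v with splitAt n v | join-splitAt n (n * m) v
  ... | inj₁ i | join≡v = subst View join≡v (vertex-of-G i)
  ... | inj₂ c | join≡v with combine-surjective {n} {m} c
  ...   | a , x , refl = subst View join≡v (vertex-of-H a x)

  component : Fin (n + n * m) → Fin n
  component v = [ id , proj₁ ]′ (decode n m v)

  component-inG : ∀ {i} → component (inG i) ≡ i
  component-inG {i} = cong [ id , proj₁ ]′ (decode-inG i)

  component-inH : ∀ {a x} → component (inH a x) ≡ a
  component-inH {a} {x} = cong [ id , proj₁ ]′ (decode-inH a x)

  inG-injective : Injective _≡_ _≡_ inG
  inG-injective = ↑ˡ-injective (n * m) _ _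

  inH-injective : ∀ {a b x y} → inH a x ≡ inH b y → a ≡ b × x ≡ y
  inH-injective = combine-injective _ _ _ _ ∘ ↑ʳ-injective n _ _

  inG≢inH : ∀ {i a x} → inG i ≢ inH a x
  inG≢inH {i} {a} {x} eq with trans (sym (decode-inG i)) (trans (cong (decode n m) eq) (decode-inH a x))
  ... | ()

  inG~inH⇒≡ : ∀ {i a x} → adj G⊙H (inG i) (inH a x) ≡ true → i ≡ a
  inG~inH⇒≡ {i} {a} {x} rewrite decode-inG i | decode-inH a x = ≟-true⇒≡

  inG~inH : ∀ {a x} → adj G⊙H (inG a) (inH a x) ≡ true
  inG~inH {a} {x} rewrite decode-inG a | decode-inH a x = ≟-refl a

  inH~inG : ∀ {a x} → adj G⊙H (inH a x) (inG a) ≡ true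
  inH~inG {a} {x} = trans (adj-sym G⊙H (inH a x) (inG a)) inG~inH

  inH~inH⇒ : ∀ {a b x y} → adj G⊙H (inH a x) (inH b y) ≡ true → a ≡ b × adj H x y ≡ true
  inH~inH⇒ {a} {b} {x} {y} rewrite decode-inH a x | decode-inH b y =
    map₁ ≟-true⇒≡ ∘ ∧≡true⁻

  inH~inH : ∀ {a x y} → adj H x y ≡ true → adj G⊙H (inH a x) (inH a y) ≡ true
  inH~inH {a} {x} {y} x~y rewrite decode-inH a x | decode-inH a y | ≟-refl a = x~y

  ~inH⇒component : ∀ {u c x} → adj G⊙H u (inH c x) ≡ true → component u ≡ c
  ~inH⇒component {u} u~ with view u
  ... | vertex-of-G i   = trans component-inG (inG~inH⇒≡ u~)
  ... | vertex-of-H a y = trans component-inH (proj₁ (inH~inH⇒ u~))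

  Dominates⇒meets-every-copy : Fin m → Dominates G⊙H D → ∀ c → ∃[ v ] v ∈ D × component v ≡ c
  Dominates⇒meets-every-copy x dom c with dom (inH c x)
  ... | inj₁ ∈D            = inH c x , ∈D , component-inH
  ... | inj₂ (u , u∈D , u~) = u , u∈D , ~inH⇒component u~

  inGs-dominate : (∀ i → inG i ∈ D) → Dominates G⊙H D
  inGs-dominate all v with view v
  ... | vertex-of-G i   = inj₁ (all i)
  ... | vertex-of-H a x = inj₂ (inG a , all a , inG~inH)

  module _ {hub : Fin m} (hub-dominates : IsDominatingVertex H hub) where

    hub-pair : Fin n × Bool → Fin (n + n * m)
    hub-pair (i , true)  = inG i
    hub-pair (i , false) = inH i hub

    hub-pair-injective : Injective _≡_ _≡_ hub-pair
    hub-pair-injective {i , true}  {j , true}  eq = cong (_, true) (inG-injective eq)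
    hub-pair-injective {i , true}  {j , false} eq = ⊥-elim (inG≢inH eq)
    hub-pair-injective {i , false} {j , true}  eq = ⊥-elim (inG≢inH (sym eq))
    hub-pair-injective {i , false} {j , false} eq = cong (_, false) (proj₁ (inH-injective eq))

    hub-pairs-dominate : ∀ D → (∀ i → ∃[ s ] hub-pair (i , s) ∈ D) → Dominates G⊙H D
    hub-pairs-dominate D covered v with view v
    ... | vertex-of-G i with covered i
    ...   | true  , ∈D = inj₁ ∈D
    ...   | false , ∈D = inj₂ (inH i hub , ∈D , inH~inG)
    hub-pairs-dominate D covered v | vertex-of-H a x with covered a | x ≟ hub
    ...   | true  , ∈D | _         = inj₂ (inG a , ∈D , inG~inH)
    ...   | false , ∈D | yes refl  = inj₁ ∈D
    ...   | false , ∈D | no x≢hub = inj₂ (inH a hub , ∈D , inH~inH (hub-dominates x x≢hub))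

    IsDominatingVertex⇒DWins-⊙ : DWins G⊙H n ⊥ ⊥
    IsDominatingVertex⇒DWins-⊙ =
      PairingStrategy.pairing-strategy G⊙H hub-pair hub-pair-injective hub-pairs-dominate

  module Copy (x₀ : Fin m) (b : Fin n) where

    π : Subset (n + n * m) → Subset m
    π = preimage (inH b)

    π-∪⁅inH⁆ : ∀ {X x} → π (X ∪ ⁅ inH b x ⁆) ≡ π X ∪ ⁅ x ⁆
    π-∪⁅inH⁆ = preimage-∪⁅⁆ (inH b) (proj₂ ∘ inH-injective)

    π-∪⁅⁆-outside : ∀ {X v} → component v ≢ b → π (X ∪ ⁅ v ⁆) ≡ π X
    π-∪⁅⁆-outside c≢b =
      preimage-∪⁅⁆-∉ (inH b) λ _ eq → c≢b (trans (cong component (sym eq)) component-inH)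

    π-⁅inG⁆ : ∀ {i} → π (⊥ ∪ ⁅ inG i ⁆) ≡ ⊥
    π-⁅inG⁆ = trans (preimage-∪⁅⁆-∉ (inH b) (λ _ → inG≢inH ∘ sym)) (preimage-⊥ (inH b))

    ∈π⁺ : ∀ {X x} → inH b x ∈ X → x ∈ π X
    ∈π⁺ = ∈-preimage⁺ (inH b)

    ∈π⁻ : ∀ {X x} → x ∈ π X → inH b x ∈ X
    ∈π⁻ = ∈-preimage⁻ (inH b)

    Dominates-copy : inG b ∉ D → Dominates G⊙H D → Dominates H (π D)
    Dominates-copy {D = D} gb∉D dom x with dom (inH b x)
    ... | inj₁ ∈D = inj₁ (∈π⁺ ∈D)
    ... | inj₂ (u , u∈D , u~) with view u
    ...   | vertex-of-G i = ⊥-elim (gb∉D (subst (λ j → inG j ∈ D) (inG~inH⇒≡ u~) u∈D))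
    ...   | vertex-of-H a y with inH~inH⇒ u~
    ...     | refl , y~x = inj₂ (y , ∈π⁺ u∈D , y~x)

    Dominates-from-copy : (∀ i → i ≢ b → inG i ∈ D) → Dominates H (π D) → Dominates G⊙H D
    Dominates-from-copy {D = D} others dom v with view v
    ... | vertex-of-G i with i ≟ b
    ...   | no i≢b = inj₁ (others i i≢b)
    ...   | yes refl with dom x₀
    ...     | inj₁ x₀∈        = inj₂ (inH b x₀ , ∈π⁻ x₀∈ , inH~inG)
    ...     | inj₂ (y , y∈ , _) = inj₂ (inH b y , ∈π⁻ y∈ , inH~inG)
    Dominates-from-copy {D = D} others dom v | vertex-of-H a x with a ≟ b
    ...   | no a≢b = inj₂ (inG a , others a a≢b , inG~inH)
    ...   | yes refl with dom x
    ...     | inj₁ x∈            = inj₁ (∈π⁻ x∈)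
    ...     | inj₂ (y , y∈ , y~x) = inj₂ (inH b y , ∈π⁻ y∈ , inH~inH y~x)

    -- Staller's answer w is read in H as w itself if w is a vertex of the copy not
    -- yet in S′, and otherwise as the free vertex y promised by the strategy in H.
    copy-answer : ∀ {D′ S′ y} → π D ≡ D′ → π S ⊆ S′ → Free D′ S′ y → Free D S w →
                  ∃[ y′ ] Free D′ S′ y′ × π (S ∪ ⁅ w ⁆) ⊆ S′ ∪ ⁅ y′ ⁆
    copy-answer {S = S} {w = w} {S′ = S′} {y} refl πS⊆S′ fy (w∉D , _)
      with any? (λ z → (inH b z ≟ w) ×-dec Dec.¬? (z ∈? S′))
    ... | yes (z , refl , z∉S′) =
      z , (w∉D ∘ ∈π⁻ , z∉S′) , subst (_⊆ S′ ∪ ⁅ z ⁆) (sym π-∪⁅inH⁆) (∪⁅⁆-⊆ πS⊆S′ y∈p∪⁅y⁆)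
    ... | no miss = y , fy , x∈p⇒x∈p∪⁅y⁆ ∘ in-S′ ∘ ∈-∪⁅⁆⁻ S ∘ ∈π⁻
      where
      in-S′ : ∀ {t} → inH b t ∈ S ⊎ inH b t ≡ w → t ∈ S′
      in-S′ (inj₁ ∈S) = πS⊆S′ (∈π⁺ ∈S)
      in-S′ {t} (inj₂ eq) = Dec.decidable-stable (t ∈? S′) (λ t∉S′ → miss (t , eq , t∉S′))

    lift : (∀ i → i ≢ b → inG i ∈ D) → ∀ {D′ S′} → DWins H k D′ S′ → π D ≡ D′ → π S ⊆ S′ →
           DWins G⊙H k D S
    lift others (won dom) refl _ = won (Dominates-from-copy others dom)
    lift {D = D} {S = S} others (move x (x∉πD , x∉S′) reply) refl πS⊆S′ =
      move (inH b x) (x∉πD ∘ ∈π⁺ , x∉S′ ∘ πS⊆S′ ∘ ∈π⁺) (lift-reply reply)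
      where
      others′ : ∀ i → i ≢ b → inG i ∈ D ∪ ⁅ inH b x ⁆
      others′ i = x∈p⇒x∈p∪⁅y⁆ ∘ others i
      lift-reply : DWinsAfter H _ (π D) _ x → DWinsAfter G⊙H _ D S (inH b x)
      lift-reply (inj₁ dom) =
        inj₁ (Dominates-from-copy others′ (subst (Dominates H) (sym π-∪⁅inH⁆) dom))
      lift-reply (inj₂ (y , (y∉ , y∉S′) , next)) =
        inj₂ (inH b y , (y∉ ∘ subst (y ∈_) π-∪⁅inH⁆ ∘ ∈π⁺ , y∉S′ ∘ πS⊆S′ ∘ ∈π⁺) , answer)
        where
        answer : ∀ w → Free (D ∪ ⁅ inH b x ⁆) S w → DWins G⊙H _ (D ∪ ⁅ inH b x ⁆) (S ∪ ⁅ w ⁆)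
        answer w fw with copy-answer π-∪⁅inH⁆ πS⊆S′ (y∉ , y∉S′) fw
        ... | y′ , fy′ , ⊆S′ = lift others′ (next y′ fy′) π-∪⁅inH⁆ ⊆S′

    record Budget (k : ℕ) (U : Subset n) (D′ S′ : Subset m) : Set where
      constructor budget
      field
        ∣U∣≤k : ∣ U ∣ ≤ k
        wins  : DWins H (k ∸ ∣ U ∣) D′ S′

    Budget-remove : ∀ {c U D′ S′} → c ∈ U → Budget k (U - c) D′ S′ → Budget (suc k) U D′ S′
    Budget-remove {k} {D′ = D′} {S′} c∈U (budget le win) =
      budget (subst (_≤ suc k) (sym ∣U∣≡) (s≤s le))
             (subst (λ u → DWins H (suc k ∸ u) D′ S′) (sym ∣U∣≡) win)
      where ∣U∣≡ = x∈p⇒∣p∣≡1+∣p-x∣ c∈U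

    Budget-suc : ∀ {U D′ S′} → Budget k U D′ S′ → Budget (suc k) U D′ S′
    Budget-suc {k} {U} (budget le win) =
      budget (m≤n⇒m≤1+n le) (DWins-mono (∸-monoˡ-≤ ∣ U ∣ (n≤1+n k)) win)

    Budget-outside : ∀ {U S′} → component v ≢ b → Budget k U (π (D ∪ ⁅ v ⁆)) S′ → Budget k U (π D) S′
    Budget-outside {k = k} {U = U} {S′ = S′} v∉b =
      subst (λ D′ → Budget k U D′ S′) (π-∪⁅⁆-outside v∉b)

    Untouched : Subset n → Subset (n + n * m) → Set
    Untouched U D = b ∉ U × (∀ v → v ∈ D → component v ∉ U)

    Untouched-∪ : ∀ {U} → Untouched U D → component v ∉ U → Untouched U (D ∪ ⁅ v ⁆)
    Untouched-∪ {D = D} (b∉U , untouched) v∉U =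
      b∉U , λ u u∈ → [ untouched u , (λ { refl → v∉U }) ]′ (∈-∪⁅⁆⁻ D u∈)

    Untouched-remove : ∀ {U} → Untouched U D → Untouched (U - component v) (D ∪ ⁅ v ⁆)
    Untouched-remove (b∉U , untouched) =
      Untouched-∪ (b∉U ∘ x∈p-y⇒x∈p , λ u u∈D → untouched u u∈D ∘ x∈p-y⇒x∈p)
                  (λ v∈ → x∈p-y⇒x≢y v∈ refl)

    Untouched⇒Empty : ∀ {U} → Untouched U D → Dominates G⊙H D → Empty U
    Untouched⇒Empty (_ , untouched) dom (c , c∈U) with Dominates⇒meets-every-copy x₀ dom c
    ... | v , v∈D , refl = untouched v v∈D c∈U

    Budget-won : ∀ {U S′} → Untouched U D → inG b ∉ D → Dominates G⊙H D → Budget k U (π D) S′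
    Budget-won {k = k} ut gb∉D dom =
      budget (subst (_≤ k) (sym ∣U∣≡0) z≤n) (won (Dominates-copy gb∉D dom))
      where ∣U∣≡0 = Empty⇒∣p∣≡0 (Untouched⇒Empty ut dom)

    inG-b∉-after : inG b ∈ S → inG b ∉ D → v ∉ S → inG b ∉ D ∪ ⁅ v ⁆
    inG-b∉-after {S = S} gb∈S gb∉D v∉S = x∉p∪⁅y⁆ gb∉D (λ eq → v∉S (subst (_∈ S) eq gb∈S))

    -- As Staller owns inG b, only vertices of the copy at b dominate that copy, so
    -- Dominator's moves there form a strategy in H; each copy in U costs him a
    -- further move.
    mutual
      project : ∀ {U} → Untouched U D → inG b ∈ S → inG b ∉ D → DWins G⊙H k D S →
                Budget k U (π D) (π S)
      project ut gb∈S gb∉D (won dom) = Budget-won ut gb∉D dom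
      project {S = S} ut gb∈S gb∉D (move v fv@(_ , v∉S) reply) with component v ≟ b
      ... | no v∉b = project-elsewhere ut gb∈S gb∉D v∉b fv reply
      ... | yes v∈b with view v
      ...   | vertex-of-G i =
        ⊥-elim (v∉S (subst (λ j → inG j ∈ S) (trans (sym v∈b) component-inG) gb∈S))
      ...   | vertex-of-H a x with trans (sym component-inH) v∈b
      ...     | refl = project-in-copy ut gb∈S gb∉D fv reply

      project-after : ∀ {U} → Untouched U (D ∪ ⁅ v ⁆) → inG b ∈ S → inG b ∉ D ∪ ⁅ v ⁆ →
                      DWinsAfter G⊙H k D S v → Budget k U (π (D ∪ ⁅ v ⁆)) (π S)
      project-after ut gb∈S gb∉D (inj₁ dom) = Budget-won ut gb∉D dom
      project-after ut gb∈S gb∉D (inj₂ (w , fw , next))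
        with budget le win ← project ut (x∈p⇒x∈p∪⁅y⁆ gb∈S) gb∉D (next w fw) =
        budget le (DWins-antimonoˢ (preimage-mono (inH b) x∈p⇒x∈p∪⁅y⁆) win)

      project-elsewhere : ∀ {U} → Untouched U D → inG b ∈ S → inG b ∉ D → component v ≢ b →
                          Free D S v → DWinsAfter G⊙H k D S v → Budget (suc k) U (π D) (π S)
      project-elsewhere {v = v} {U = U} ut gb∈S gb∉D v∉b (_ , v∉S) reply with component v ∈? U
      ... | yes v∈U = Budget-remove v∈U (Budget-outside v∉b
                        (project-after (Untouched-remove ut) gb∈S (inG-b∉-after gb∈S gb∉D v∉S) reply))
      ... | no v∉U = Budget-suc (Budget-outside v∉b
                        (project-after (Untouched-∪ ut v∉U) gb∈S (inG-b∉-after gb∈S gb∉D v∉S) reply))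

      project-in-copy : ∀ {U x} → Untouched U D → inG b ∈ S → inG b ∉ D → Free D S (inH b x) →
                        DWinsAfter G⊙H k D S (inH b x) → Budget (suc k) U (π D) (π S)
      project-in-copy {D = D} {S = S} {k = k} {U = U} {x = x} ut gb∈S gb∉D (x∉D , x∉S) reply =
        budget (m≤n⇒m≤1+n ∣U∣≤k) (subst (λ j → DWins H j (π D) (π S)) (sym (+-∸-assoc 1 ∣U∣≤k))
                                         (move x (x∉D ∘ ∈π⁻ , x∉S ∘ ∈π⁻) (copy-reply reply)))
        where
        ut′ : Untouched U (D ∪ ⁅ inH b x ⁆)
        ut′ = Untouched-∪ ut (subst (_∉ U) (sym component-inH) (proj₁ ut))
        gb∉D′ : inG b ∉ D ∪ ⁅ inH b x ⁆
        gb∉D′ = inG-b∉-after gb∈S gb∉D x∉S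
        ∣U∣≤k : ∣ U ∣ ≤ k
        ∣U∣≤k = Budget.∣U∣≤k (project-after ut′ gb∈S gb∉D′ reply)
        wins-after : (∀ w → Free (D ∪ ⁅ inH b x ⁆) S w → DWins G⊙H k (D ∪ ⁅ inH b x ⁆) (S ∪ ⁅ w ⁆)) →
                     ∀ {w} → Free (D ∪ ⁅ inH b x ⁆) S w →
                     DWins H (k ∸ ∣ U ∣) (π D ∪ ⁅ x ⁆) (π (S ∪ ⁅ w ⁆))
        wins-after next fw = subst (λ D′ → DWins H _ D′ _) π-∪⁅inH⁆
                                   (Budget.wins (project ut′ (x∈p⇒x∈p∪⁅y⁆ gb∈S) gb∉D′ (next _ fw)))
        copy-reply : DWinsAfter G⊙H k D S (inH b x) → DWinsAfter H (k ∸ ∣ U ∣) (π D) (π S) x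
        copy-reply (inj₁ dom) = inj₁ (subst (Dominates H) π-∪⁅inH⁆ (Dominates-copy gb∉D′ dom))
        copy-reply (inj₂ (w , fw , next)) with any? (free? (π D ∪ ⁅ x ⁆) (π S))
        ... | yes (y , fy) = inj₂ (y , fy , λ y′ (y′∉D , y′∉S) → subst (DWins H _ _) π-∪⁅inH⁆
                               (wins-after next (y′∉D ∘ subst (y′ ∈_) π-∪⁅inH⁆ ∘ ∈π⁺ , y′∉S ∘ ∈π⁺)))
        ... | no stuck = inj₁ (DWins-stuck⇒Dominates stuck (preimage-mono (inH b) x∈p⇒x∈p∪⁅y⁆)
                                                     (wins-after next fw))

another : ∀ {n} (a : Fin (suc (suc n))) → ∃[ b ] b ≢ a
another zero    = suc zero , λ ()
another (suc a) = zero , λ ()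

module _ {n m} (G : Graph (suc (suc n))) (H : Graph m) (x₀ : Fin m) where
  open Corona G H

  DWins-⊙⇒DWins : DWins G⊙H (suc k) ⊥ ⊥ → n ≤ k × DWins H (k ∸ n) ⊥ ⊥
  DWins-⊙⇒DWins (won dom) = ⊥-elim (¬Dominates-⊥ {Γ = G⊙H} (inG zero) dom)
  DWins-⊙⇒DWins {k} (move v _ reply) with another (component v)
  ... | b , b≢v = after-first-move reply
    where
    open Copy x₀ b
    open ≡-Reasoning

    gb∉D : inG b ∉ ⊥ ∪ ⁅ v ⁆
    gb∉D = x∉p∪⁅y⁆ ∉⊥ (b≢v ∘ trans (sym component-inG) ∘ cong component)

    U : Subset (suc (suc n))
    U = ⊤ - component v - b

    ∣U∣≡n : ∣ U ∣ ≡ n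
    ∣U∣≡n = suc-injective (suc-injective (begin
      suc (suc ∣ U ∣)          ≡⟨ cong suc (x∈p⇒∣p∣≡1+∣p-x∣ (x∈p∧x≢y⇒x∈p-y ∈⊤ b≢v)) ⟨
      suc ∣ ⊤ - component v ∣ ≡⟨ x∈p⇒∣p∣≡1+∣p-x∣ {x = component v} ∈⊤ ⟨
      ∣ ⊤ {suc (suc n)} ∣      ≡⟨ ∣⊤∣≡n (suc (suc n)) ⟩
      suc (suc n)              ∎))

    untouched : Untouched U (⊥ ∪ ⁅ v ⁆)
    untouched = Untouched-∪ ((λ b∈U → x∈p-y⇒x≢y b∈U refl) , (λ _ → ⊥-elim ∘ ∉⊥))
                            (λ v∈U → x∈p-y⇒x≢y (x∈p-y⇒x∈p v∈U) refl)

    after-first-move : DWinsAfter G⊙H k ⊥ ⊥ v → n ≤ k × DWins H (k ∸ n) ⊥ ⊥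
    after-first-move (inj₁ dom) with Dominates⇒meets-every-copy x₀ dom b
    ... | u , u∈D , refl = ⊥-elim ([ ∉⊥ , (λ { refl → b≢v refl }) ]′ (∈-∪⁅⁆⁻ ⊥ u∈D))
    after-first-move (inj₂ (_ , _ , next))
      with budget ∣U∣≤k wins ← project untouched y∈p∪⁅y⁆ gb∉D (next (inG b) (gb∉D , ∉⊥)) =
      subst (λ u → u ≤ k × DWins H (k ∸ u) ⊥ ⊥) ∣U∣≡n
        (∣U∣≤k , subst₂ (DWins H _) (trans (π-∪⁅⁆-outside (b≢v ∘ sym)) (preimage-⊥ (inH b)))
                                     π-⁅inG⁆ wins)

module _ {m} (G : Graph 2) (H : Graph m) (x₀ : Fin m) where
  open Corona G H
  open Copy x₀ (suc zero)

  DWins⇒DWins-⊙₂ : DWins H (suc k) ⊥ ⊥ → DWins G⊙H (suc (suc k)) ⊥ ⊥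
  DWins⇒DWins-⊙₂ {k} wins =
    move (inG zero) (∉⊥ , ∉⊥) (inj₂ (inG (suc zero) , (g₁∉D , ∉⊥) , answer))
    where
    D₁ : Subset _
    D₁ = ⊥ ∪ ⁅ inG zero ⁆

    g₀∈D₁ : inG zero ∈ D₁
    g₀∈D₁ = y∈p∪⁅y⁆ {y = inG zero} {p = ⊥}

    g₁∉D : inG (suc zero) ∉ D₁
    g₁∉D = x∉p∪⁅y⁆ {p = ⊥} {y = inG zero} ∉⊥ (λ eq → case inG-injective eq of λ ())

    answer : ∀ w → Free D₁ ⊥ w → DWins G⊙H (suc k) D₁ (⊥ ∪ ⁅ w ⁆)
    answer w _ with w ≟ inG (suc zero)
    ... | yes refl = lift {D = D₁} {S = ⊥ ∪ ⁅ inG (suc zero) ⁆}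
                          (λ { zero _ → g₀∈D₁ ; (suc zero) 1≢1 → ⊥-elim (1≢1 refl) })
                          wins (π-⁅inG⁆ {zero}) (⊆-reflexive (π-⁅inG⁆ {suc zero}))
    ... | no w≢g₁  = move (inG (suc zero)) (g₁∉D , x∉p∪⁅y⁆ {p = ⊥} ∉⊥ (w≢g₁ ∘ sym))
                          (inj₁ (inGs-dominate {D = D₁ ∪ ⁅ inG (suc zero) ⁆} λ where
                            zero       → x∈p⇒x∈p∪⁅y⁆ {y = inG (suc zero)} g₀∈D₁
                            (suc zero) → y∈p∪⁅y⁆ {p = D₁}))

γMB-⊙≡3⇒ : ∀ {n m} (G : Graph (suc (suc n))) (H : Graph (suc m)) → γMB≡ (corona G H) 3 →
           (suc (suc n) ≡ 2 × γMB≡ H 2) ⊎ (suc (suc n) ≡ 3 × HasDominatingVertex H)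
γMB-⊙≡3⇒ {0} G H (wins₃ , fewer-fail) =
  inj₁ (refl , proj₂ (DWins-⊙⇒DWins G H zero wins₃) , λ where
    0 _        → ¬DWins-0 zero
    1 _ winsH₁ → fewer-fail 2 (s≤s (s≤s (s≤s z≤n)))
                   (Corona.IsDominatingVertex⇒DWins-⊙ G H (proj₂ (DWins-1⇒HasDominatingVertex zero winsH₁)))
    (suc (suc _)) (s≤s (s≤s ())))
γMB-⊙≡3⇒ {1} G H (wins₃ , _) =
  inj₂ (refl , DWins-1⇒HasDominatingVertex zero (proj₂ (DWins-⊙⇒DWins G H zero wins₃)))
γMB-⊙≡3⇒ {2} G H (wins₃ , _) = ⊥-elim (¬DWins-0 zero (proj₂ (DWins-⊙⇒DWins G H zero wins₃)))
γMB-⊙≡3⇒ {suc (suc (suc _))} G H (wins₃ , _) =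
  case proj₁ (DWins-⊙⇒DWins G H zero wins₃) of λ { (s≤s (s≤s ())) }

⇒γMB-⊙≡3 : ∀ {n m} (G : Graph (suc (suc n))) (H : Graph (suc m)) →
           (suc (suc n) ≡ 2 × γMB≡ H 2) ⊎ (suc (suc n) ≡ 3 × HasDominatingVertex H) → γMB≡ (corona G H) 3
⇒γMB-⊙≡3 {0} G H (inj₁ (_ , winsH₂ , fewer-failH)) = DWins⇒DWins-⊙₂ G H zero winsH₂ , λ where
  0 _ → ¬DWins-0 (Corona.inG G H zero)
  (suc j) (s≤s j<2) wins → fewer-failH j j<2 (proj₂ (DWins-⊙⇒DWins G H zero wins))
⇒γMB-⊙≡3 {1} G H (inj₂ (_ , _ , hub-dominates)) =
  Corona.IsDominatingVertex⇒DWins-⊙ G H hub-dominates , λ where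
  0 _ → ¬DWins-0 (Corona.inG G H zero)
  1 _ wins → case proj₁ (DWins-⊙⇒DWins G H zero wins) of λ ()
  2 _ wins → ¬DWins-0 zero (proj₂ (DWins-⊙⇒DWins G H zero wins))
  (suc (suc (suc _))) (s≤s (s≤s (s≤s ())))
⇒γMB-⊙≡3 {suc _} G H (inj₁ (() , _))
⇒γMB-⊙≡3 {0} G H (inj₂ (() , _))
⇒γMB-⊙≡3 {suc (suc _)} G H (inj₂ (() , _))

proposition4p8 : (n m : ℕ) → 2 ≤ n → 1 ≤ m → (G : Graph n) (H : Graph m) →
    γMB≡ (corona G H) 3 ⇔ ((n ≡ 2 × γMB≡ H 2) ⊎ (n ≡ 3 × HasDominatingVertex H))
proposition4p8 (suc (suc n)) (suc m) _ _ G H = mk⇔ (γMB-⊙≡3⇒ G H) (⇒γMB-⊙≡3 G H)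
proposition4p8 (suc zero) _ (s≤s ()) _ _ _
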